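{- For every finite or infinite sequence $\mathbf f$ over $\{ -1,1\}$, the only squares (factors of the form $zz$ with $z$ nonempty) occurring in the run-length sequence $R_{\mathbf f}$ are among $22$, $123123$, and $321321$.
   Context: For a finite sequence $\mathbf f$ over $\{ -1,1\}$ define $P_\epsilon=\epsilon$ (empty) and $P_{\mathbf f a}=P_{\mathbf f}\ a\ (-P_{\mathbf f}^R)$ for $a\in\{ -1,1\}$, where $-x$ negates every entry and $x^R$ is reversal. For an infinite $\mathbf f=f_0f_1\cdots$, $P_{\mathbf f}$ is the unique infinite sequence having every $P_{f_0\cdots f_n}$ as a prefix. A run is a maximal block of consecutive identical entries; the run-length sequence $R_{\mathbf f}$ is the sequence of lengths of the runs of $P_{\mathbf f}$ from left to right (a word over $\{1,2,3\}$). A factor is a contiguous block. -}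

module Defs where

open import Data.Nat using (ℕ; zero; suc; _+_)
open import Data.List using (List; []; _∷_; _++_; map; reverse; foldl; applyUpTo)
open import Data.Sign.Base using (Sign; opposite) renaming (+ to plus)
open import Data.Sign.Properties using (_≟_)
open import Data.Product using (Σ; _×_; _,_)
open import Data.Sum using (_⊎_)
open import Relation.Nullary using (¬_; does)
open import Relation.Binary.PropositionalEquality using (_≡_; _≢_)
open import Data.Bool using (if_then_else_)

-- Entries of {-1,1} are represented by Sign (- for -1, + for 1);
-- negation of a sequence is map opposite.

Pstep : List Sign → Sign → List Sign
Pstep p a = p ++ (a ∷ map opposite (reverse p))

P : List Sign → List Sign
P f = foldl Pstep [] f

runGo : Sign → ℕ → List Sign → List ℕ
runGo x n [] = n ∷ []
runGo x n (y ∷ ys) = if does (x ≟ y) then runGo x (suc n) ys else (n ∷ runGo y 1 ys)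

runLengths : List Sign → List ℕ
runLengths [] = []
runLengths (x ∷ xs) = runGo x 1 xs

R : List Sign → List ℕ
R f = runLengths (P f)

IsFactor : {A : Set} → List A → List A → Set
IsFactor {A} w u = Σ (List A) λ x → Σ (List A) λ y → u ≡ x ++ (w ++ y)

-- i-th entry of a list, with a default (never used below since lengths suffice)
nthD : {A : Set} → A → List A → ℕ → A
nthD d [] i = d
nthD d (x ∷ xs) zero = x
nthD d (x ∷ xs) (suc i) = nthD d xs i

prefix : (ℕ → Sign) → ℕ → List Sign
prefix f n = applyUpTo f n

-- infinite P_f: entry i equals entry i of P_{f_0..f_i}, which has length 2^{i+1}-1 > i
-- and is a prefix of every later P_{f_0..f_n}
Pinf : (ℕ → Sign) → ℕ → Sign
Pinf f i = nthD plus (P (prefix f (suc i))) i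

segment : (ℕ → Sign) → ℕ → ℕ → List Sign
segment g i len = applyUpTo (λ k → g (i + k)) len

-- a finite word w is a factor of the run-length sequence of the infinite word g
-- iff w is the run-length sequence of a nonempty block g_i..g_{i+m} consisting
-- of complete (maximal) runs: it starts at 0 or after a change of letter, and is
-- followed by a change of letter.
IsRunFactorInf : List ℕ → (ℕ → Sign) → Set
IsRunFactorInf w g = Σ ℕ λ i → Σ ℕ λ m →
  (i ≡ 0 ⊎ Σ ℕ (λ k → (i ≡ suc k) × (g k ≢ g i))) ×
  (g (i + m) ≢ g (i + suc m)) ×
  (runLengths (segment g i (suc m)) ≡ w)

AllowedSquareRoot : List ℕ → Set
AllowedSquareRoot z = (z ≡ 2 ∷ []) ⊎ (z ≡ 1 ∷ 2 ∷ 3 ∷ []) ⊎ (z ≡ 3 ∷ 2 ∷ 1 ∷ [])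

-- Let G be P_f with one letter prepended. The odd positions of G carry the
-- alternating letters f₀ (−f₀) f₀ ⋯ and the even positions carry the word of the same kind
-- built from f₁f₂⋯. A square zz of the run-length sequence sits on complete runs, so the
-- two blocks of G it encodes agree up to a global sign s, and the letters just outside
-- them extend this to a signed period L on a window of length 2L + 2. At odd positions an
-- odd period is impossible; an even period L = 2M has sign (−1)^M, M even leads to an
-- infinite descent through the even positions, and odd M ≥ 7 is excluded by comparing odd
-- positions four apart. So L ∈ {2, 6, 10}, and the finitely many windows of these lengths
-- are checked by evaluation.

module Submission where

open import Defs
open import Data.Empty using (⊥; ⊥-elim)
open import Data.List
  using (List; []; _∷_; _++_; _∷ʳ_; map; reverse; foldl; applyUpTo; upTo; length; take; drop; concatMap)
open import Data.List.Properties
  using (map-++; length-map; length-reverse; length-applyUpTo; map-applyUpTo; foldl-++; unfold-reverse; ++-assoc;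
         ++-identityʳ; ++-conicalˡ; ++-conicalʳ; ∷-injective; ∷-injectiveʳ)
import Data.List.Properties as List
open import Data.List.Membership.Propositional using (_∈_)
open import Data.List.Membership.Propositional.Properties using (∈-map⁺; ∈-++⁺ˡ; ∈-++⁺ʳ; ∈-concatMap⁺)
open import Data.List.Relation.Unary.All using (All; all?)
import Data.List.Relation.Unary.All as All
open import Data.List.Relation.Unary.All.Properties using (applyUpTo⁺₁)
open import Data.List.Relation.Unary.Any using (here; there)
import Data.List.Relation.Unary.Any as Any
open import Data.Nat using (ℕ; zero; suc; _+_; _≤_; _<_; z≤n; s≤s; ⌈_/2⌉)
import Data.Nat as ℕ
open import Data.Nat.Induction using (<-rec)
open import Data.Nat.Properties
  using (+-suc; +-comm; +-assoc; +-identityʳ; n≤1+n; 1+n≰n; ≤-refl; ≤-reflexive; ≤-trans; ≤-total; m≤m+n;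
         m<m+n; +-mono-≤; +-monoˡ-≤; +-monoʳ-≤; m≤n⇒∃[o]m+o≡n; m<1+n⇒m<n∨m≡n; ⌊n/2⌋≤⌈n/2⌉; ⌊n/2⌋+⌈n/2⌉≡n)
open import Data.Nat.Tactic.RingSolver using (solve-∀)
open import Data.Product using (Σ; _×_; _,_; proj₁)
open import Data.Sign.Base using (Sign; opposite; _*_) renaming (+ to plus; - to minus)
open import Data.Sign.Properties
  using (_≟_; opposite-involutive; s≢opposite[s]; s*s≡+; *-assoc; *-comm; *-cancelˡ-≡; *-cancelʳ-≡;
         opposite[s]*s≡-)
open import Data.Sum using (_⊎_; inj₁; inj₂)
open import Function using (_∘_)
open import Relation.Nullary using (Dec; yes; no; ¬?; _⊎-dec_; _→-dec_)
open import Relation.Nullary.Decidable using (from-yes)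
open import Relation.Binary.PropositionalEquality
  using (_≡_; _≢_; refl; sym; trans; cong; cong₂; subst; module ≡-Reasoning)
open ≡-Reasoning

opposite^ : ℕ → Sign → Sign
opposite^ zero    a = a
opposite^ (suc n) a = opposite (opposite^ n a)

opposite^-opposite : ∀ n a → opposite^ n (opposite a) ≡ opposite (opposite^ n a)
opposite^-opposite zero    a = refl
opposite^-opposite (suc n) a = cong opposite (opposite^-opposite n a)

opposite^-+ : ∀ m n a → opposite^ (m + n) a ≡ opposite^ m (opposite^ n a)
opposite^-+ zero    n a = refl
opposite^-+ (suc m) n a = cong opposite (opposite^-+ m n a)

opposite^-involutive : ∀ n a → opposite^ n (opposite^ n a) ≡ a
opposite^-involutive zero    a = refl
opposite^-involutive (suc n) a = begin
  opposite (opposite^ n (opposite (opposite^ n a))) ≡⟨ cong opposite (opposite^-opposite n _) ⟩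
  opposite (opposite (opposite^ n (opposite^ n a))) ≡⟨ opposite-involutive _ ⟩
  opposite^ n (opposite^ n a)                       ≡⟨ opposite^-involutive n a ⟩
  a                                                 ∎

opposite^-double : ∀ n a → opposite^ (n + n) a ≡ a
opposite^-double n a = trans (opposite^-+ n n a) (opposite^-involutive n a)

opposite^-odd : ∀ n a → opposite^ (suc (n + n)) a ≢ a
opposite^-odd n a eq = s≢opposite[s] a (trans (sym eq) (cong opposite (opposite^-double n a)))

opposite-* : ∀ x a → opposite (x * a) ≡ opposite x * a
opposite-* plus  a = refl
opposite-* minus a = opposite-involutive a

opposite^-* : ∀ n a → opposite^ n a ≡ opposite^ n plus * a
opposite^-* zero    a = refl
opposite^-* (suc n) a = trans (cong opposite (opposite^-* n a)) (opposite-* (opposite^ n plus) a)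

s*[s*x]≡x : ∀ s x → s * (s * x) ≡ x
s*[s*x]≡x s x = trans (sym (*-assoc s s x)) (cong (_* x) (s*s≡+ s))

≢⇒≡opposite : ∀ {a b} → a ≢ b → a ≡ opposite b
≢⇒≡opposite {plus}  {plus}  a≢b = ⊥-elim (a≢b refl)
≢⇒≡opposite {plus}  {minus} _   = refl
≢⇒≡opposite {minus} {plus}  _   = refl
≢⇒≡opposite {minus} {minus} a≢b = ⊥-elim (a≢b refl)

*-opposite : ∀ s b → s * opposite b ≡ opposite (s * b)
*-opposite plus  b = refl
*-opposite minus b = refl

*-swap : ∀ a b x y → a * x ≡ b * y → y ≡ (a * b) * x
*-swap a b x y eq = begin
  y               ≡⟨ sym (s*[s*x]≡x b y) ⟩
  b * (b * y)     ≡⟨ cong (b *_) (sym eq) ⟩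
  b * (a * x)     ≡⟨ sym (*-assoc b a x) ⟩
  (b * a) * x     ≡⟨ cong (_* x) (*-comm b a) ⟩
  (a * b) * x     ∎

plus⊎minus : ∀ {P : Sign → Set} s → P s → P plus ⊎ P minus
plus⊎minus plus  p = inj₁ p
plus⊎minus minus p = inj₂ p

even⊎odd : ∀ k → (Σ ℕ λ m → k ≡ m + m) ⊎ (Σ ℕ λ m → k ≡ suc (m + m))
even⊎odd zero          = inj₁ (0 , refl)
even⊎odd (suc zero)    = inj₂ (0 , refl)
even⊎odd (suc (suc k)) with even⊎odd k
... | inj₁ (m , refl) = inj₁ (suc m , cong suc (sym (+-suc m m)))
... | inj₂ (m , refl) = inj₂ (suc m , cong (suc ∘ suc) (sym (+-suc m m)))

opposite^-fixed⇒even : ∀ n a → opposite^ n a ≡ a → Σ ℕ λ m → n ≡ m + m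
opposite^-fixed⇒even n a fixed with even⊎odd n
... | inj₁ even          = even
... | inj₂ (m , refl)    = ⊥-elim (opposite^-odd m a fixed)

odd-within-2 : ∀ k → Σ ℕ λ t → t < 2 × Σ ℕ λ m → k + t ≡ suc (m + m)
odd-within-2 k with even⊎odd k
... | inj₁ (m , refl) = 1 , s≤s (s≤s z≤n) , m , +-comm (m + m) 1
... | inj₂ (m , refl) = 0 , s≤s z≤n , m , +-comm (suc (m + m)) 0

twice-odd-within-4 : ∀ k → Σ ℕ λ t → t ≤ 3 × Σ ℕ λ u → k + t ≡ suc (u + u) + suc (u + u)
twice-odd-within-4 zero                      = 2 , s≤s (s≤s z≤n) , 0 , refl
twice-odd-within-4 (suc zero)                = 1 , s≤s z≤n , 0 , refl
twice-odd-within-4 (suc (suc zero))          = 0 , z≤n , 0 , refl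
twice-odd-within-4 (suc (suc (suc zero)))    = 3 , ≤-refl , 1 , refl
twice-odd-within-4 (suc (suc (suc (suc k)))) with twice-odd-within-4 k
... | t , t≤3 , u , eq = t , t≤3 , suc u , trans (cong (4 +_) eq) (index u)
  where
  index : ∀ u → 4 + (suc (u + u) + suc (u + u)) ≡ suc (suc u + suc u) + suc (suc u + suc u)
  index = solve-∀

interleave : Sign → List Sign → List Sign
interleave a []      = a ∷ []
interleave a (x ∷ w) = a ∷ x ∷ interleave (opposite a) w

interleave-++ : ∀ a w b v →
  interleave a (w ++ b ∷ v) ≡ interleave a w ++ b ∷ interleave (opposite (opposite^ (length w) a)) v
interleave-++ a []      b v = refl
interleave-++ a (x ∷ w) b v = cong (λ t → a ∷ x ∷ t) (begin
  interleave (opposite a) (w ++ b ∷ v)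
    ≡⟨ interleave-++ (opposite a) w b v ⟩
  interleave (opposite a) w ++ b ∷ interleave (opposite (opposite^ (length w) (opposite a))) v
    ≡⟨ cong (λ c → interleave (opposite a) w ++ b ∷ interleave (opposite c) v)
            (opposite^-opposite (length w) a) ⟩
  interleave (opposite a) w ++ b ∷ interleave (opposite (opposite^ (length (x ∷ w)) a)) v ∎)

length-opposite-reverse : ∀ w → length (map opposite (reverse w)) ≡ length w
length-opposite-reverse w = trans (length-map opposite (reverse w)) (length-reverse w)

opposite-reverse-interleave : ∀ a w →
  map opposite (reverse (interleave a w))
    ≡ interleave (opposite (opposite^ (length w) a)) (map opposite (reverse w))
opposite-reverse-interleave a []      = refl
opposite-reverse-interleave a (x ∷ w) = begin
  map opposite (reverse (a ∷ x ∷ interleave (opposite a) w))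
    ≡⟨ cong (map opposite) (reverse-∷-∷ a x (interleave (opposite a) w)) ⟩
  map opposite (reverse (interleave (opposite a) w) ++ x ∷ a ∷ [])
    ≡⟨ map-++ opposite (reverse (interleave (opposite a) w)) _ ⟩
  map opposite (reverse (interleave (opposite a) w)) ++ opposite x ∷ opposite a ∷ []
    ≡⟨ cong₂ (λ u e → u ++ opposite x ∷ e ∷ []) reversed-tail last≡ ⟩
  interleave c (map opposite (reverse w)) ++ opposite x ∷ interleave (opposite (opposite^ (length w′) c)) []
    ≡⟨ sym (interleave-++ c w′ (opposite x) []) ⟩
  interleave c (w′ ++ opposite x ∷ [])
    ≡⟨ cong (interleave c) (sym (trans (cong (map opposite) (unfold-reverse x w)) (map-++ opposite (reverse w) _))) ⟩
  interleave c (map opposite (reverse (x ∷ w))) ∎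
  where
  w′ = map opposite (reverse w)
  c  = opposite (opposite^ (length (x ∷ w)) a)
  reversed-tail : map opposite (reverse (interleave (opposite a) w)) ≡ interleave c w′
  reversed-tail = trans (opposite-reverse-interleave (opposite a) w)
                        (cong (λ e → interleave (opposite e) w′) (opposite^-opposite (length w) a))
  reverse-∷-∷ : ∀ (a x : Sign) u → reverse (a ∷ x ∷ u) ≡ reverse u ++ x ∷ a ∷ []
  reverse-∷-∷ a x u = begin
    reverse (a ∷ x ∷ u)         ≡⟨ unfold-reverse a (x ∷ u) ⟩
    reverse (x ∷ u) ∷ʳ a        ≡⟨ cong (_∷ʳ a) (unfold-reverse x u) ⟩
    (reverse u ∷ʳ x) ∷ʳ a       ≡⟨ ++-assoc (reverse u) _ _ ⟩
    reverse u ++ x ∷ a ∷ []     ∎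
  last≡ : opposite a ≡ opposite (opposite^ (length w′) c)
  last≡ = cong opposite (sym (begin
    opposite^ (length w′) c
      ≡⟨ cong (λ n → opposite^ n c) (length-opposite-reverse w) ⟩
    opposite^ (length w) (opposite (opposite (opposite^ (length w) a)))
      ≡⟨ cong (opposite^ (length w)) (opposite-involutive _) ⟩
    opposite^ (length w) (opposite^ (length w) a)
      ≡⟨ opposite^-involutive (length w) a ⟩
    a ∎))

Pstep-interleave : ∀ a w b → Pstep (interleave a w) b ≡ interleave a (Pstep w b)
Pstep-interleave a w b = begin
  interleave a w ++ b ∷ map opposite (reverse (interleave a w))
    ≡⟨ cong (λ u → interleave a w ++ b ∷ u) (opposite-reverse-interleave a w) ⟩
  interleave a w ++ b ∷ interleave (opposite (opposite^ (length w) a)) (map opposite (reverse w))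
    ≡⟨ sym (interleave-++ a w b _) ⟩
  interleave a (w ++ b ∷ map opposite (reverse w)) ∎

foldl-Pstep-interleave : ∀ a w u → foldl Pstep (interleave a w) u ≡ interleave a (foldl Pstep w u)
foldl-Pstep-interleave a w []      = refl
foldl-Pstep-interleave a w (b ∷ u) =
  trans (cong (λ t → foldl Pstep t u) (Pstep-interleave a w b)) (foldl-Pstep-interleave a (Pstep w b) u)

P-∷ : ∀ a u → P (a ∷ u) ≡ interleave a (P u)
P-∷ a u = foldl-Pstep-interleave a [] u

lookup-interleave-even : ∀ d a w m → m ≤ length w → nthD d (interleave a w) (m + m) ≡ opposite^ m a
lookup-interleave-even d a []      zero    _         = refl
lookup-interleave-even d a (x ∷ w) zero    _         = refl
lookup-interleave-even d a (x ∷ w) (suc m) (s≤s m≤w) = begin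
  nthD d (x ∷ interleave (opposite a) w) (m + suc m) ≡⟨ cong (nthD d (x ∷ _)) (+-suc m m) ⟩
  nthD d (interleave (opposite a) w) (m + m)        ≡⟨ lookup-interleave-even d (opposite a) w m m≤w ⟩
  opposite^ m (opposite a)                          ≡⟨ opposite^-opposite m a ⟩
  opposite^ (suc m) a                               ∎

lookup-interleave-odd : ∀ d a w m → m < length w → nthD d (interleave a w) (suc (m + m)) ≡ nthD d w m
lookup-interleave-odd d a (x ∷ w) zero    _         = refl
lookup-interleave-odd d a (x ∷ w) (suc m) (s≤s m<w) = begin
  nthD d (interleave (opposite a) w) (m + suc m)     ≡⟨ cong (nthD d (interleave (opposite a) w)) (+-suc m m) ⟩
  nthD d (interleave (opposite a) w) (suc (m + m))   ≡⟨ lookup-interleave-odd d (opposite a) w m m<w ⟩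
  nthD d w m                                         ∎

length-interleave : ∀ a w → length w < length (interleave a w)
length-interleave a []      = s≤s z≤n
length-interleave a (x ∷ w) = s≤s (≤-trans (length-interleave (opposite a) w) (n≤1+n _))

length-P : ∀ u → length u ≤ length (P u)
length-P []      = z≤n
length-P (a ∷ u) = subst (suc (length u) ≤_) (cong length (sym (P-∷ a u)))
                         (≤-trans (s≤s (length-P u)) (length-interleave a (P u)))

foldl-Pstep-extends : ∀ p u → Σ (List Sign) λ r → foldl Pstep p u ≡ p ++ r
foldl-Pstep-extends p []      = [] , sym (++-identityʳ p)
foldl-Pstep-extends p (b ∷ u) with foldl-Pstep-extends (Pstep p b) u
... | r , eq = b ∷ map opposite (reverse p) ++ r , trans eq (++-assoc p _ r)

applyUpTo-+ : ∀ {A : Set} (g : ℕ → A) m n → applyUpTo g (m + n) ≡ applyUpTo g m ++ applyUpTo (g ∘ (m +_)) n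
applyUpTo-+ g zero    n = refl
applyUpTo-+ g (suc m) n = cong (g 0 ∷_) (applyUpTo-+ (g ∘ suc) m n)

P-prefix-extends : ∀ g m n → Σ (List Sign) λ r → P (prefix g (m + n)) ≡ P (prefix g m) ++ r
P-prefix-extends g m n with foldl-Pstep-extends (P (prefix g m)) (applyUpTo (g ∘ (m +_)) n)
... | r , eq = r , trans (cong P (applyUpTo-+ g m n)) (trans (foldl-++ Pstep [] (prefix g m) _) eq)

nthD-++ˡ : ∀ {A : Set} (d : A) xs ys j → j < length xs → nthD d (xs ++ ys) j ≡ nthD d xs j
nthD-++ˡ d (x ∷ xs) ys zero    _         = refl
nthD-++ˡ d (x ∷ xs) ys (suc j) (s≤s j<xs) = nthD-++ˡ d xs ys j j<xs

nthD-P-prefix : ∀ g m n j → m ≤ n → j < length (P (prefix g m)) →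
  nthD plus (P (prefix g n)) j ≡ nthD plus (P (prefix g m)) j
nthD-P-prefix g m n j m≤n j<P with m≤n⇒∃[o]m+o≡n m≤n
... | k , refl with P-prefix-extends g m k
... | r , eq = trans (cong (λ w → nthD plus w j) eq) (nthD-++ˡ plus (P (prefix g m)) r j j<P)

length-P-prefix : ∀ g n → n ≤ length (P (prefix g n))
length-P-prefix g n = subst (_≤ length (P (prefix g n))) (length-applyUpTo g n) (length-P (prefix g n))

Pinf-lookup : ∀ g n j → j < length (P (prefix g n)) → Pinf g j ≡ nthD plus (P (prefix g n)) j
Pinf-lookup g n j j<P with ≤-total (suc j) n
... | inj₁ j<n = sym (nthD-P-prefix g (suc j) n j j<n (length-P-prefix g (suc j)))
... | inj₂ n≤j = nthD-P-prefix g n (suc j) j n≤j j<P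

Pinf-≡-interleave : ∀ f j → Pinf f j ≡ nthD plus (interleave (f 0) (P (prefix (f ∘ suc) j))) j
Pinf-≡-interleave f j = cong (λ w → nthD plus w j) (P-∷ (f 0) (prefix (f ∘ suc) j))

Pinf-even : ∀ f m → Pinf f (m + m) ≡ opposite^ m (f 0)
Pinf-even f m = trans (Pinf-≡-interleave f (m + m))
  (lookup-interleave-even plus (f 0) (P (prefix (f ∘ suc) (m + m))) m
    (≤-trans (m≤m+n m m) (length-P-prefix (f ∘ suc) (m + m))))

Pinf-odd : ∀ f m → Pinf f (suc (m + m)) ≡ Pinf (f ∘ suc) m
Pinf-odd f m = begin
  Pinf f (suc (m + m))                                      ≡⟨ Pinf-≡-interleave f (suc (m + m)) ⟩
  nthD plus (interleave (f 0) (P u)) (suc (m + m))          ≡⟨ lookup-interleave-odd plus (f 0) (P u) m m<P ⟩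
  nthD plus (P u) m                                         ≡⟨ sym (Pinf-lookup (f ∘ suc) (suc (m + m)) m m<P) ⟩
  Pinf (f ∘ suc) m                                          ∎
  where
  u = prefix (f ∘ suc) (suc (m + m))
  m<P : m < length (P u)
  m<P = ≤-trans (s≤s (m≤m+n m m)) (length-P-prefix (f ∘ suc) (suc (m + m)))

Ppad : Sign → (ℕ → Sign) → ℕ → Sign
Ppad v f zero    = v
Ppad v f (suc j) = Pinf f j

Ppad-odd : ∀ v f m → Ppad v f (suc (m + m)) ≡ opposite^ m (f 0)
Ppad-odd v f m = Pinf-even f m

Ppad-even : ∀ v f m → Ppad v f (m + m) ≡ Ppad v (f ∘ suc) m
Ppad-even v f zero    = refl
Ppad-even v f (suc m) = trans (cong (Pinf f) (+-suc m m)) (Pinf-odd f m)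

Ppad-odd-+ : ∀ v f m N → Ppad v f (suc (m + m) + (N + N)) ≡ opposite^ N (Ppad v f (suc (m + m)))
Ppad-odd-+ v f m N = begin
  Ppad v f (suc (m + m) + (N + N)) ≡⟨ cong (Ppad v f) (index m N) ⟩
  Ppad v f (suc ((N + m) + (N + m))) ≡⟨ Ppad-odd v f (N + m) ⟩
  opposite^ (N + m) (f 0) ≡⟨ opposite^-+ N m (f 0) ⟩
  opposite^ N (opposite^ m (f 0)) ≡⟨ cong (opposite^ N) (sym (Ppad-odd v f m)) ⟩
  opposite^ N (Ppad v f (suc (m + m))) ∎
  where
  index : ∀ m N → suc (m + m) + (N + N) ≡ suc ((N + m) + (N + m))
  index = solve-∀

SignPeriodic : (ℕ → Sign) → ℕ → ℕ → ℕ → Sign → Set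
SignPeriodic G k L c s = ∀ t → t < c → G (k + t + L) ≡ s * G (k + t)

SignPeriodic-twice : ∀ {G k L c s} t → SignPeriodic G k L c s → t + L < c → G (k + t + (L + L)) ≡ G (k + t)
SignPeriodic-twice {G} {k} {L} {c} {s} t per t+L<c = begin
  G (k + t + (L + L))   ≡⟨ cong G (index k t L) ⟩
  G (k + (t + L) + L)   ≡⟨ per (t + L) t+L<c ⟩
  s * G (k + (t + L))   ≡⟨ cong (λ i → s * G i) (sym (+-assoc k t L)) ⟩
  s * G (k + t + L)     ≡⟨ cong (s *_) (per t (≤-trans (s≤s (m≤m+n t L)) t+L<c)) ⟩
  s * (s * G (k + t))   ≡⟨ s*[s*x]≡x s (G (k + t)) ⟩
  G (k + t)             ∎
  where
  index : ∀ k t L → k + t + (L + L) ≡ k + (t + L) + L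
  index = solve-∀

-- Two steps of an odd period L lead from one odd position to another, which carries the
-- opposite letter.
odd-period-impossible : ∀ v f k n s → SignPeriodic (Ppad v f) k (suc (n + n)) (2 + suc (n + n)) s → ⊥
odd-period-impossible v f k n s per with odd-within-2 k
... | t , t<2 , m , k+t≡odd = opposite^-odd n (G (k + t)) (begin
  opposite^ L (G (k + t))          ≡⟨ cong (opposite^ L ∘ G) k+t≡odd ⟩
  opposite^ L (G (suc (m + m)))    ≡⟨ sym (Ppad-odd-+ v f m L) ⟩
  G (suc (m + m) + (L + L))        ≡⟨ cong (λ i → G (i + (L + L))) (sym k+t≡odd) ⟩
  G (k + t + (L + L))              ≡⟨ SignPeriodic-twice {G} {k} {s = s} t per t+L<2+L ⟩
  G (k + t)                        ∎)
  where
  G = Ppad v f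
  L = suc (n + n)
  t+L<2+L : t + L < 2 + L
  t+L<2+L = +-mono-≤ t<2 ≤-refl

even-period-sign : ∀ v f k M c s → SignPeriodic (Ppad v f) k (M + M) c s → 2 ≤ c → s ≡ opposite^ M plus
even-period-sign v f k M c s per 2≤c with odd-within-2 k
... | t , t<2 , m , k+t≡odd = sym (*-cancelʳ-≡ (G (k + t)) _ _ (begin
  opposite^ M plus * G (k + t)     ≡⟨ sym (opposite^-* M (G (k + t))) ⟩
  opposite^ M (G (k + t))          ≡⟨ cong (opposite^ M ∘ G) k+t≡odd ⟩
  opposite^ M (G (suc (m + m)))    ≡⟨ sym (Ppad-odd-+ v f m M) ⟩
  G (suc (m + m) + (M + M))        ≡⟨ cong (λ i → G (i + (M + M))) (sym k+t≡odd) ⟩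
  G (k + t + (M + M))              ≡⟨ per t (≤-trans t<2 2≤c) ⟩
  s * G (k + t)                    ∎))
  where
  G = Ppad v f

SignPeriodic-even-position : ∀ v f k M c s → SignPeriodic (Ppad v f) k (M + M) c s →
  ∀ y t → k + t ≡ y + y → t < c → Ppad v (f ∘ suc) (y + M) ≡ s * Ppad v (f ∘ suc) y
SignPeriodic-even-position v f k M c s per y t k+t≡y+y t<c = begin
  H (y + M)                   ≡⟨ sym (Ppad-even v f (y + M)) ⟩
  G ((y + M) + (y + M))       ≡⟨ cong G (index y M) ⟩
  G ((y + y) + (M + M))       ≡⟨ cong (λ i → G (i + (M + M))) (sym k+t≡y+y) ⟩
  G (k + t + (M + M))         ≡⟨ per t t<c ⟩
  s * G (k + t)               ≡⟨ cong (λ i → s * G i) k+t≡y+y ⟩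
  s * G (y + y)               ≡⟨ cong (s *_) (Ppad-even v f y) ⟩
  s * H y                     ∎
  where
  G = Ppad v f
  H = Ppad v (f ∘ suc)
  index : ∀ y M → (y + M) + (y + M) ≡ (y + y) + (M + M)
  index = solve-∀

suc-double-< : ∀ {t c} → t < c → suc (t + t) < c + c
suc-double-< {t} {c} t<c = subst (_≤ c + c) (cong suc (+-suc t t)) (+-mono-≤ t<c t<c)

SignPeriodic-halve : ∀ v f k M c c′ s → SignPeriodic (Ppad v f) k (M + M) c s → c′ + c′ ≤ c →
  Σ ℕ λ k′ → SignPeriodic (Ppad v (f ∘ suc)) k′ M c′ s
SignPeriodic-halve v f k M c c′ s per c′+c′≤c with even⊎odd k
... | inj₁ (q , refl) = q , λ t′ t′<c′ →
  SignPeriodic-even-position v f k M c s per (q + t′) (t′ + t′) (index q t′)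
    (≤-trans (n≤1+n _) (≤-trans (suc-double-< t′<c′) c′+c′≤c))
  where
  index : ∀ q t′ → q + q + (t′ + t′) ≡ (q + t′) + (q + t′)
  index = solve-∀
... | inj₂ (q , refl) = suc q , λ t′ t′<c′ →
  SignPeriodic-even-position v f k M c s per (suc q + t′) (suc (t′ + t′)) (index q t′)
    (≤-trans (suc-double-< t′<c′) c′+c′≤c)
  where
  index : ∀ q t′ → suc (q + q) + suc (t′ + t′) ≡ (suc q + t′) + (suc q + t′)
  index = solve-∀

1≤n+n⇒1≤n : ∀ n → 1 ≤ n + n → 1 ≤ n
1≤n+n⇒1≤n (suc n) _ = s≤s z≤n

-- Halving a +-period 2N keeps it a +-period of the shifted word; it cannot be halved forever.
no-plus-even-period : ∀ N → 1 ≤ N → ∀ v f k c → N + N ≤ c → SignPeriodic (Ppad v f) k (N + N) c plus → ⊥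
no-plus-even-period = <-rec NoPlusPeriod step
  where
  NoPlusPeriod : ℕ → Set
  NoPlusPeriod N = 1 ≤ N → ∀ v f k c → N + N ≤ c → SignPeriodic (Ppad v f) k (N + N) c plus → ⊥
  step : ∀ N → (∀ {N′} → N′ < N → NoPlusPeriod N′) → NoPlusPeriod N
  step N rec 1≤N v f k c N+N≤c per
    with opposite^-fixed⇒even N plus
           (sym (even-period-sign v f k N c plus per (≤-trans (+-mono-≤ 1≤N 1≤N) N+N≤c)))
  ... | N′ , refl with SignPeriodic-halve v f k (N′ + N′) c (N′ + N′) plus per N+N≤c
  ... | k′ , per′ = rec (m<m+n N′ 1≤N′) 1≤N′ v (f ∘ suc) k′ (N′ + N′) ≤-refl per′
    where
    1≤N′ : 1 ≤ N′
    1≤N′ = 1≤n+n⇒1≤n N′ 1≤N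

-- Compare two odd positions 4 apart inside the window: they carry the same letter, so the
-- letters at the even positions 2p and 2p + 4 before them agree; for p odd these are the
-- odd positions p and p + 2 of the shifted word, which carry opposite letters.
long-odd-period-impossible : ∀ v f k n s →
  SignPeriodic (Ppad v f) k (suc (n + n)) (suc (suc (n + n))) s → 3 ≤ n → ⊥
long-odd-period-impossible v f k n s per 3≤n with twice-odd-within-4 k
... | t , t≤3 , u , k+t≡p+p = s≢opposite[s] (H p) (begin
  H p                          ≡⟨ sym (Ppad-even v f p) ⟩
  G (p + p)                    ≡⟨ cong G (sym k+t≡p+p) ⟩
  G (k + t)                    ≡⟨ *-cancelˡ-≡ s _ _ s*G-equal ⟩
  G (k + (t + 4))              ≡⟨ cong G (trans (sym (+-assoc k t 4)) (trans (cong (_+ 4) k+t≡p+p) (index₃ p))) ⟩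
  G ((p + 2) + (p + 2))        ≡⟨ Ppad-even v f (p + 2) ⟩
  H (p + 2)                    ≡⟨ Ppad-odd-+ v (f ∘ suc) u 1 ⟩
  opposite (H p)               ∎)
  where
  G = Ppad v f
  H = Ppad v (f ∘ suc)
  p = suc (u + u)
  M = suc (n + n)
  m = p + n
  t+4<M+1 : t + 4 < suc M
  t+4<M+1 = s≤s (≤-trans (+-mono-≤ t≤3 (≤-refl {4})) (s≤s (+-mono-≤ 3≤n 3≤n)))
  index₁ : ∀ k t M → k + (t + 4) + M ≡ (k + t) + M + (2 + 2)
  index₁ = solve-∀
  index₂ : ∀ p n → p + p + suc (n + n) ≡ suc ((p + n) + (p + n))
  index₂ = solve-∀
  index₃ : ∀ p → p + p + 4 ≡ (p + 2) + (p + 2)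
  index₃ = solve-∀
  shifted-equal : G (k + (t + 4) + M) ≡ G (k + t + M)
  shifted-equal = begin
    G (k + (t + 4) + M)              ≡⟨ cong G (trans (index₁ k t M) (cong (λ i → i + M + (2 + 2)) k+t≡p+p)) ⟩
    G (p + p + M + (2 + 2))          ≡⟨ cong (λ i → G (i + (2 + 2))) (index₂ p n) ⟩
    G (suc (m + m) + (2 + 2))        ≡⟨ Ppad-odd-+ v f m 2 ⟩
    opposite (opposite (G (suc (m + m)))) ≡⟨ opposite-involutive _ ⟩
    G (suc (m + m))                  ≡⟨ cong G (sym (trans (cong (_+ M) k+t≡p+p) (index₂ p n))) ⟩
    G (k + t + M)                    ∎
  s*G-equal : s * G (k + t) ≡ s * G (k + (t + 4))
  s*G-equal = trans (sym (per t (≤-trans (s≤s (m≤m+n t 4)) t+4<M+1)))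
                    (trans (sym shifted-equal) (per (t + 4) t+4<M+1))

even-period-lengths : ∀ v f k M s → SignPeriodic (Ppad v f) k (M + M) (2 + (M + M)) s → 1 ≤ M →
  M ≡ 1 ⊎ M ≡ 3 ⊎ M ≡ 5
even-period-lengths v f k M s per 1≤M
  with SignPeriodic-halve v f k M _ (suc M) s per (≤-reflexive (index M))
  where
  index : ∀ M → suc M + suc M ≡ 2 + (M + M)
  index = solve-∀
... | k′ , per′ with even⊎odd M
... | inj₁ (N , refl) =
  ⊥-elim (no-plus-even-period N (1≤n+n⇒1≤n N 1≤M) v (f ∘ suc) k′ (suc (N + N)) (n≤1+n _)
            (subst (SignPeriodic (Ppad v (f ∘ suc)) k′ (N + N) (suc (N + N))) s≡+ per′))
  where
  s≡+ : s ≡ plus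
  s≡+ = trans (even-period-sign v f k (N + N) _ s per (s≤s (s≤s z≤n))) (opposite^-double N plus)
... | inj₂ (0 , refl) = inj₁ refl
... | inj₂ (1 , refl) = inj₂ (inj₁ refl)
... | inj₂ (2 , refl) = inj₂ (inj₂ refl)
... | inj₂ (suc (suc (suc n)) , refl) =
  ⊥-elim (long-odd-period-impossible v (f ∘ suc) k′ (3 + n) s per′ (s≤s (s≤s (s≤s z≤n))))

period-lengths : ∀ v f k L s → SignPeriodic (Ppad v f) k L (2 + L) s → 1 ≤ L → L ≡ 2 ⊎ L ≡ 6 ⊎ L ≡ 10
period-lengths v f k L s per 1≤L with even⊎odd L
... | inj₂ (n , refl) = ⊥-elim (odd-period-impossible v f k n s per)
... | inj₁ (M , refl) with even-period-lengths v f k M s per (1≤n+n⇒1≤n M 1≤L)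
... | inj₁ refl        = inj₁ refl
... | inj₂ (inj₁ refl) = inj₂ (inj₁ refl)
... | inj₂ (inj₂ refl) = inj₂ (inj₂ refl)

applyUpTo-cong : ∀ {A : Set} {g h : ℕ → A} n → (∀ t → t < n → g t ≡ h t) → applyUpTo g n ≡ applyUpTo h n
applyUpTo-cong zero    g≗h = refl
applyUpTo-cong (suc n) g≗h =
  cong₂ _∷_ (g≗h 0 (s≤s z≤n)) (applyUpTo-cong n (λ t t<n → g≗h (suc t) (s≤s t<n)))

segment-suc : ∀ g k n → segment g k (suc n) ≡ g k ∷ segment g (suc k) n
segment-suc g k n = cong₂ _∷_ (cong g (+-identityʳ k)) (applyUpTo-cong n (λ t _ → cong g (+-suc k t)))

nthD-segment : ∀ g k n t → t < n → nthD plus (segment g k n) t ≡ g (k + t)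
nthD-segment g k (suc n) zero    _         = refl
nthD-segment g k (suc n) (suc t) (s≤s t<n) = begin
  nthD plus (segment g k (suc n)) (suc t) ≡⟨ cong (λ w → nthD plus w (suc t)) (segment-suc g k n) ⟩
  nthD plus (segment g (suc k) n) t       ≡⟨ nthD-segment g (suc k) n t t<n ⟩
  g (suc k + t)                           ≡⟨ cong g (sym (+-suc k t)) ⟩
  g (k + suc t)                           ∎

RunBoundary : (ℕ → Sign) → ℕ → Set
RunBoundary G i = G i ≢ G (suc i)

runGo-same : ∀ {x y} c ys → x ≡ y → runGo x c (y ∷ ys) ≡ runGo x (suc c) ys
runGo-same {x} {y} c ys x≡y with x ≟ y
... | yes _   = refl
... | no  x≢y = ⊥-elim (x≢y x≡y)

runGo-change : ∀ {x y} c ys → x ≢ y → runGo x c (y ∷ ys) ≡ c ∷ runGo y 1 ys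
runGo-change {x} {y} c ys x≢y with x ≟ y
... | yes x≡y = ⊥-elim (x≢y x≡y)
... | no  _   = refl

runGo-head-≥ : ∀ x c ys {c′ r} → runGo x c ys ≡ c′ ∷ r → c ≤ c′
runGo-head-≥ x c []       refl = ≤-refl
runGo-head-≥ x c (y ∷ ys) eq with x ≟ y
... | yes _ = ≤-trans (n≤1+n c) (runGo-head-≥ x (suc c) ys eq)
... | no  _ with refl ← eq = ≤-refl

runGo-≢-[] : ∀ x c ys → runGo x c ys ≢ []
runGo-≢-[] x c []       ()
runGo-≢-[] x c (y ∷ ys) eq with x ≟ y
... | yes _ = runGo-≢-[] x (suc c) ys eq
... | no  _ with () ← eq

runGo-singleton : ∀ x c ys → runGo x c ys ≡ c ∷ [] → ys ≡ []
runGo-singleton x c []       _  = refl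
runGo-singleton x c (y ∷ ys) eq with x ≟ y
... | yes _ = ⊥-elim (1+n≰n (runGo-head-≥ x (suc c) ys eq))
... | no  _ = ⊥-elim (runGo-≢-[] y 1 ys (∷-injectiveʳ eq))

-- Relative to its leading letter, a word is determined by its run lengths.
runGo-injective : ∀ x y c ys ys′ → runGo x c ys ≡ runGo y c ys′ → map (x *_) ys ≡ map (y *_) ys′
runGo-injective x y c []       []         _  = refl
runGo-injective x y c []       (z′ ∷ zs′) eq with () ← runGo-singleton y c (z′ ∷ zs′) (sym eq)
runGo-injective x y c (z ∷ zs) []         eq with () ← runGo-singleton x c (z ∷ zs) eq
runGo-injective x y c (z ∷ zs) (z′ ∷ zs′) eq with x ≟ z | y ≟ z′
... | yes refl | yes refl =
  cong₂ _∷_ (trans (s*s≡+ x) (sym (s*s≡+ y))) (runGo-injective x y (suc c) zs zs′ eq)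
... | no x≢z | no y≢z′ = cong₂ _∷_
  (trans (cong (_* z) (≢⇒≡opposite x≢z)) (trans (opposite[s]*s≡- z)
    (sym (trans (cong (_* z′) (≢⇒≡opposite y≢z′)) (opposite[s]*s≡- z′)))))
  (begin
    map (x *_) zs                 ≡⟨ map-opposite-* x≢z zs ⟩
    map opposite (map (z *_) zs)  ≡⟨ cong (map opposite) (runGo-injective z z′ 1 zs zs′ (∷-injectiveʳ eq)) ⟩
    map opposite (map (z′ *_) zs′) ≡⟨ sym (map-opposite-* y≢z′ zs′) ⟩
    map (y *_) zs′                ∎)
  where
  map-opposite-* : ∀ {a b} → a ≢ b → ∀ ws → map (a *_) ws ≡ map opposite (map (b *_) ws)
  map-opposite-* a≢b []       = refl
  map-opposite-* {b = b} a≢b (w ∷ ws) =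
    cong₂ _∷_ (trans (cong (_* w) (≢⇒≡opposite a≢b)) (sym (opposite-* b w))) (map-opposite-* a≢b ws)
... | yes _ | no _ = ⊥-elim (1+n≰n (runGo-head-≥ x (suc c) zs eq))
... | no _  | yes _ = ⊥-elim (1+n≰n (runGo-head-≥ y (suc c) zs′ (sym eq)))

runLengths-segment : ∀ G k n → runLengths (segment G k (suc n)) ≡ runGo (G k) 1 (segment G (suc k) n)
runLengths-segment G k n = cong runLengths (segment-suc G k n)

runGo-segment-same : ∀ G {x} c k n → x ≡ G k →
  runGo x c (segment G k (suc n)) ≡ runGo x (suc c) (segment G (suc k) n)
runGo-segment-same G c k n x≡Gk =
  trans (cong (runGo _ c) (segment-suc G k n)) (runGo-same c (segment G (suc k) n) x≡Gk)

runGo-segment-change : ∀ G {x} c k n → x ≢ G k →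
  runGo x c (segment G k (suc n)) ≡ c ∷ runGo (G k) 1 (segment G (suc k) n)
runGo-segment-change G c k n x≢Gk =
  trans (cong (runGo _ c) (segment-suc G k n)) (runGo-change c (segment G (suc k) n) x≢Gk)

runGo-split : ∀ G x k n c d u v → x ≡ G k → v ≢ [] → runGo x c (segment G (suc k) n) ≡ (d ∷ u) ++ v →
  Σ ℕ λ n₁ → Σ ℕ λ n₂ → n ≡ n₁ + suc n₂ × runGo x c (segment G (suc k) n₁) ≡ d ∷ u
    × RunBoundary G (k + n₁) × runLengths (segment G (suc (k + n₁)) (suc n₂)) ≡ v
runGo-split G x k zero c d u v _ v≢[] eq = ⊥-elim (v≢[] (++-conicalʳ u v (sym (∷-injectiveʳ eq))))
runGo-split G x k (suc n) c d u v x≡Gk v≢[] eq with x ≟ G (suc k)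
... | yes x≡Gk′
  with runGo-split G x (suc k) n (suc c) d u v x≡Gk′ v≢[]
         (trans (sym (runGo-segment-same G c (suc k) n x≡Gk′)) eq)
... | n₁ , n₂ , refl , first , boundary , second =
  suc n₁ , n₂ , refl , trans (runGo-segment-same G c (suc k) n₁ x≡Gk′) first ,
  subst (RunBoundary G) (sym (+-suc k n₁)) boundary ,
  subst (λ i → runLengths (segment G (suc i) (suc n₂)) ≡ v) (sym (+-suc k n₁)) second
runGo-split G x k (suc n) c d u v x≡Gk v≢[] eq | no x≢Gk′
  with ∷-injective (trans (sym (runGo-segment-change G c (suc k) n x≢Gk′)) eq)
runGo-split G x k (suc n) c d [] v x≡Gk v≢[] eq | no x≢Gk′ | refl , rest =
  0 , n , refl , refl ,
  subst (RunBoundary G) (sym (+-identityʳ k)) (λ Gk≡Gk′ → x≢Gk′ (trans x≡Gk Gk≡Gk′)) ,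
  subst (λ i → runLengths (segment G (suc i) (suc n)) ≡ v) (sym (+-identityʳ k))
    (trans (runLengths-segment G (suc k) n) rest)
runGo-split G x k (suc n) c d (d′ ∷ u) v x≡Gk v≢[] eq | no x≢Gk′ | refl , rest
  with runGo-split G (G (suc k)) (suc k) n 1 d′ u v refl v≢[] rest
... | n₁ , n₂ , refl , first , boundary , second =
  suc n₁ , n₂ , refl , trans (runGo-segment-change G c (suc k) n₁ x≢Gk′) (cong (c ∷_) first) ,
  subst (RunBoundary G) (sym (+-suc k n₁)) boundary ,
  subst (λ i → runLengths (segment G (suc i) (suc n₂)) ≡ v) (sym (+-suc k n₁)) second

-- G_{k+1} ⋯ G_{k+1+m} is a union of complete runs of G with run-length sequence w.
RunBlock : (ℕ → Sign) → ℕ → ℕ → List ℕ → Set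
RunBlock G k m w = RunBoundary G k × RunBoundary G (suc k + m) × runLengths (segment G (suc k) (suc m)) ≡ w

RunBlock-split : ∀ G k m w v → w ≢ [] → v ≢ [] → RunBlock G k m (w ++ v) →
  Σ ℕ λ n₁ → Σ ℕ λ n₂ → m ≡ n₁ + suc n₂ × RunBlock G k n₁ w × RunBlock G (suc k + n₁) n₂ v
RunBlock-split G k m []      v w≢[] _    _ = ⊥-elim (w≢[] refl)
RunBlock-split G k m (d ∷ u) v _    v≢[] (start , end , runs)
  with runGo-split G (G (suc k)) (suc k) m 1 d u v refl v≢[] (trans (sym (runLengths-segment G (suc k) m)) runs)
... | n₁ , n₂ , refl , first , boundary , second =
  n₁ , n₂ , refl ,
  (start , boundary , trans (runLengths-segment G (suc k) n₁) first) ,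
  (boundary , subst (RunBoundary G) (index k n₁ n₂) end , second)
  where
  index : ∀ k n₁ n₂ → suc k + (n₁ + suc n₂) ≡ suc (suc k + n₁) + n₂
  index = solve-∀

RunBlock-factor : ∀ G k m x w y → w ≢ [] → RunBlock G k m (x ++ w ++ y) →
  Σ ℕ λ k′ → Σ ℕ λ m′ → RunBlock G k′ m′ w
RunBlock-factor G k m [] w [] _ block = k , m , subst (RunBlock G k m) (++-identityʳ w) block
RunBlock-factor G k m [] w (y ∷ ys) w≢[] block with RunBlock-split G k m w (y ∷ ys) w≢[] (λ ()) block
... | n₁ , _ , _ , first , _ = k , n₁ , first
RunBlock-factor G k m (x ∷ xs) w y w≢[] block
  with RunBlock-split G k m (x ∷ xs) (w ++ y) (λ ()) (w≢[] ∘ ++-conicalˡ w y) block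
... | n₁ , n₂ , _ , _ , rest = RunBlock-factor G (suc k + n₁) n₂ [] w y w≢[] rest

applyUpTo-injective : ∀ {A : Set} (g h : ℕ → A) m n → applyUpTo g m ≡ applyUpTo h n →
  m ≡ n × (∀ t → t < m → g t ≡ h t)
applyUpTo-injective g h zero    zero    _  = refl , λ _ ()
applyUpTo-injective g h (suc m) (suc n) eq with ∷-injective eq
... | g0≡h0 , rest with applyUpTo-injective (g ∘ suc) (h ∘ suc) m n rest
... | refl , pointwise = refl , λ { zero _ → g0≡h0 ; (suc t) (s≤s t<m) → pointwise t t<m }

runLengths-segment-injective : ∀ G i j m n → runLengths (segment G i (suc m)) ≡ runLengths (segment G j (suc n)) →
  m ≡ n × (∀ t → t ≤ m → G (j + t) ≡ (G i * G j) * G (i + t))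
runLengths-segment-injective G i j m n eq with applyUpTo-injective _ _ m n (begin
    applyUpTo ((G i *_) ∘ (λ t → G (suc i + t))) m  ≡⟨ sym (map-applyUpTo _ (G i *_) m) ⟩
    map (G i *_) (segment G (suc i) m)               ≡⟨ runGo-injective (G i) (G j) 1 _ _ runs-equal ⟩
    map (G j *_) (segment G (suc j) n)               ≡⟨ map-applyUpTo _ (G j *_) n ⟩
    applyUpTo ((G j *_) ∘ (λ t → G (suc j + t))) n  ∎)
  where
  runs-equal : runGo (G i) 1 (segment G (suc i) m) ≡ runGo (G j) 1 (segment G (suc j) n)
  runs-equal = trans (sym (runLengths-segment G i m)) (trans eq (runLengths-segment G j n))
... | refl , pointwise = refl , shift
  where
  shift : ∀ t → t ≤ m → G (j + t) ≡ (G i * G j) * G (i + t)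
  shift zero    _   = begin
    G (j + 0)               ≡⟨ cong G (+-identityʳ j) ⟩
    G j                     ≡⟨ *-swap (G i) (G j) (G i) (G j) (trans (s*s≡+ (G i)) (sym (s*s≡+ (G j)))) ⟩
    (G i * G j) * G i       ≡⟨ cong (λ x → (G i * G j) * G x) (sym (+-identityʳ i)) ⟩
    (G i * G j) * G (i + 0) ∎
  shift (suc t) t<m = begin
    G (j + suc t)               ≡⟨ cong G (+-suc j t) ⟩
    G (suc j + t)               ≡⟨ *-swap (G i) (G j) _ _ (pointwise t t<m) ⟩
    (G i * G j) * G (suc i + t) ≡⟨ cong (λ x → (G i * G j) * G x) (sym (+-suc i t)) ⟩
    (G i * G j) * G (i + suc t) ∎

-- In a square z z of complete runs the second z-block is the first times a sign s; the
-- letters bounding the two blocks extend this to a signed period on a window two longer.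
RunBlock-square⇒SignPeriodic : ∀ G k m z → z ≢ [] → RunBlock G k m (z ++ z) →
  Σ ℕ λ n → Σ Sign λ s → SignPeriodic G k (suc n) (2 + suc n) s × runLengths (segment G (suc k) (suc n)) ≡ z
RunBlock-square⇒SignPeriodic G k m z z≢[] block with RunBlock-split G k m z z z≢[] z≢[] block
... | n₁ , n₂ , _ , (start , middle , first) , (_ , end , second)
  with runLengths-segment-injective G (suc k) (suc (suc k + n₁)) n₁ n₂ (trans first (sym second))
... | refl , shift = n₁ , s , periodic , first
  where
  i = suc k
  j = suc (i + n₁)
  s = G i * G j
  L = suc n₁
  periodic-start : G (k + 0 + L) ≡ s * G (k + 0)
  periodic-start = begin
    G (k + 0 + L)        ≡⟨ cong G (index k n₁) ⟩
    G (i + n₁)           ≡⟨ ≢⇒≡opposite middle ⟩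
    opposite (G j)       ≡⟨ cong (opposite ∘ G) (sym (+-identityʳ j)) ⟩
    opposite (G (j + 0)) ≡⟨ cong opposite (shift 0 z≤n) ⟩
    opposite (s * G (i + 0)) ≡⟨ cong (λ x → opposite (s * G x)) (+-identityʳ i) ⟩
    opposite (s * G i)   ≡⟨ sym (*-opposite s (G i)) ⟩
    s * opposite (G i)   ≡⟨ cong (s *_) (sym (≢⇒≡opposite start)) ⟩
    s * G k              ≡⟨ cong (λ x → s * G x) (sym (+-identityʳ k)) ⟩
    s * G (k + 0)        ∎
    where
    index : ∀ k n₁ → k + 0 + suc n₁ ≡ suc k + n₁
    index = solve-∀
  periodic-inside : ∀ t → t ≤ n₁ → G (k + suc t + L) ≡ s * G (k + suc t)
  periodic-inside t t≤n₁ = begin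
    G (k + suc t + L)    ≡⟨ cong G (index k t n₁) ⟩
    G (j + t)            ≡⟨ shift t t≤n₁ ⟩
    s * G (i + t)        ≡⟨ cong (λ x → s * G x) (sym (+-suc k t)) ⟩
    s * G (k + suc t)    ∎
    where
    index : ∀ k t n₁ → k + suc t + suc n₁ ≡ suc (suc k + n₁) + t
    index = solve-∀
  periodic-end : G (k + suc L + L) ≡ s * G (k + suc L)
  periodic-end = begin
    G (k + suc L + L)           ≡⟨ cong G (index₁ k n₁) ⟩
    G (suc (j + n₁))            ≡⟨ ≢⇒≡opposite (end ∘ sym) ⟩
    opposite (G (j + n₁))       ≡⟨ cong opposite (shift n₁ ≤-refl) ⟩
    opposite (s * G (i + n₁))   ≡⟨ sym (*-opposite s (G (i + n₁))) ⟩
    s * opposite (G (i + n₁))   ≡⟨ cong (s *_) (sym (≢⇒≡opposite (middle ∘ sym))) ⟩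
    s * G j                     ≡⟨ cong (λ x → s * G x) (index₂ k n₁) ⟩
    s * G (k + suc L)           ∎
    where
    index₁ : ∀ k n₁ → k + suc (suc n₁) + suc n₁ ≡ suc (suc (suc k + n₁) + n₁)
    index₁ = solve-∀
    index₂ : ∀ k n₁ → suc (suc k + n₁) ≡ k + suc (suc n₁)
    index₂ = solve-∀
  periodic : SignPeriodic G k L (2 + L) s
  periodic zero    _             = periodic-start
  periodic (suc t) (s≤s t<1+L) with m<1+n⇒m<n∨m≡n t<1+L
  ... | inj₁ (s≤s t≤n₁) = periodic-inside t t≤n₁
  ... | inj₂ refl       = periodic-end

mutual
  weaveFromWord : ℕ → Sign → List Sign → List Sign
  weaveFromWord zero    b u       = []
  weaveFromWord (suc n) b []      = []
  weaveFromWord (suc n) b (x ∷ u) = x ∷ weaveFromSign n b u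

  weaveFromSign : ℕ → Sign → List Sign → List Sign
  weaveFromSign zero    b u = []
  weaveFromSign (suc n) b u = b ∷ weaveFromWord n (opposite b) u

mutual
  segment-even : ∀ v f m n h → n ≤ h + h →
    segment (Ppad v f) (m + m) n ≡ weaveFromWord n (opposite^ m (f 0)) (segment (Ppad v (f ∘ suc)) m h)
  segment-even v f m zero    h       _         = refl
  segment-even v f m (suc n) (suc h) (s≤s n≤) = begin
    segment G (m + m) (suc n)
      ≡⟨ segment-suc G (m + m) n ⟩
    G (m + m) ∷ segment G (suc (m + m)) n
      ≡⟨ cong₂ _∷_ (Ppad-even v f m) (segment-odd v f m n h (subst (n ≤_) (+-suc h h) n≤)) ⟩
    H m ∷ weaveFromSign n (opposite^ m (f 0)) (segment H (suc m) h)
      ≡⟨ cong (weaveFromWord (suc n) (opposite^ m (f 0))) (sym (segment-suc H m h)) ⟩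
    weaveFromWord (suc n) (opposite^ m (f 0)) (segment H m (suc h)) ∎
    where
    G = Ppad v f
    H = Ppad v (f ∘ suc)

  segment-odd : ∀ v f m n h → n ≤ suc (h + h) →
    segment (Ppad v f) (suc (m + m)) n ≡ weaveFromSign n (opposite^ m (f 0)) (segment (Ppad v (f ∘ suc)) (suc m) h)
  segment-odd v f m zero    h _         = refl
  segment-odd v f m (suc n) h (s≤s n≤) = begin
    segment G (suc (m + m)) (suc n)
      ≡⟨ segment-suc G (suc (m + m)) n ⟩
    G (suc (m + m)) ∷ segment G (suc (suc (m + m))) n
      ≡⟨ cong₂ _∷_ (Ppad-odd v f m) (cong (λ i → segment G i n) (cong suc (sym (+-suc m m)))) ⟩
    opposite^ m (f 0) ∷ segment G (suc m + suc m) n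
      ≡⟨ cong (opposite^ m (f 0) ∷_) (segment-even v f (suc m) n h n≤) ⟩
    opposite^ m (f 0) ∷ weaveFromWord n (opposite^ (suc m) (f 0)) (segment (Ppad v (f ∘ suc)) (suc m) h) ∎
    where
    G = Ppad v f

words : ℕ → List (List Sign)
words zero    = [] ∷ []
words (suc n) = map (plus ∷_) (words n) ++ map (minus ∷_) (words n)

∈-words : ∀ w → w ∈ words (length w)
∈-words []          = here refl
∈-words (plus ∷ w)  = ∈-++⁺ˡ (∈-map⁺ (plus ∷_) (∈-words w))
∈-words (minus ∷ w) = ∈-++⁺ʳ (map (plus ∷_) (words (length w))) (∈-map⁺ (minus ∷_) (∈-words w))

weavings : ℕ → List Sign → List (List Sign)
weavings n u =
  weaveFromWord n plus u ∷ weaveFromWord n minus u ∷ weaveFromSign n plus u ∷ weaveFromSign n minus u ∷ []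

-- A superset of the length-n factors of all padded paperfolding words: unfold the
-- even/odd decomposition d times, then take all words of the remaining length.
windows : ℕ → ℕ → List (List Sign)
windows zero    n = words n
windows (suc d) n = concatMap (weavings n) (windows d ⌈ n /2⌉)

∈-concatMap : ∀ {A B : Set} (h : A → List B) {x xs y} → x ∈ xs → y ∈ h x → y ∈ concatMap h xs
∈-concatMap h x∈xs y∈hx = ∈-concatMap⁺ h (Any.map (λ { refl → y∈hx }) x∈xs)

n≤⌈n/2⌉+⌈n/2⌉ : ∀ n → n ≤ ⌈ n /2⌉ + ⌈ n /2⌉
n≤⌈n/2⌉+⌈n/2⌉ n =
  subst (_≤ ⌈ n /2⌉ + ⌈ n /2⌉) (⌊n/2⌋+⌈n/2⌉≡n n) (+-monoˡ-≤ ⌈ n /2⌉ (⌊n/2⌋≤⌈n/2⌉ n))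

segment-∈-windows : ∀ d n v f k → segment (Ppad v f) k n ∈ windows d n
segment-∈-windows zero    n v f k =
  subst (λ l → segment (Ppad v f) k n ∈ words l) (length-applyUpTo _ n) (∈-words (segment (Ppad v f) k n))
segment-∈-windows (suc d) n v f k with even⊎odd k
... | inj₁ (m , refl) =
  subst (_∈ windows (suc d) n) (sym (segment-even v f m n h (n≤⌈n/2⌉+⌈n/2⌉ n)))
    (∈-concatMap (weavings n) (segment-∈-windows d h v (f ∘ suc) m) (weaveFromWord-∈ (opposite^ m (f 0))))
  where
  h = ⌈ n /2⌉
  weaveFromWord-∈ : ∀ b {u} → weaveFromWord n b u ∈ weavings n u
  weaveFromWord-∈ plus  = here refl
  weaveFromWord-∈ minus = there (here refl)
... | inj₂ (m , refl) =
  subst (_∈ windows (suc d) n) (sym (segment-odd v f m n h (≤-trans (n≤⌈n/2⌉+⌈n/2⌉ n) (n≤1+n _))))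
    (∈-concatMap (weavings n) (segment-∈-windows d h v (f ∘ suc) (suc m)) (weaveFromSign-∈ (opposite^ m (f 0))))
  where
  h = ⌈ n /2⌉
  weaveFromSign-∈ : ∀ b {u} → weaveFromSign n b u ∈ weavings n u
  weaveFromSign-∈ plus  = there (there (here refl))
  weaveFromSign-∈ minus = there (there (there (here refl)))

PeriodicWindow : ℕ → Sign → List Sign → Set
PeriodicWindow L s W = All (λ t → nthD plus W (t + L) ≡ s * nthD plus W t) (upTo (2 + L))

-- W stands for G_k ⋯ G_{k+2L+1}, around a square whose root spans G_{k+1} ⋯ G_{k+L}.
GoodWindow : ℕ → List Sign → Set
GoodWindow L W = nthD plus W 0 ≢ nthD plus W 1 → PeriodicWindow L plus W ⊎ PeriodicWindow L minus W →
  AllowedSquareRoot (runLengths (take L (drop 1 W)))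

allowed? : ∀ z → Dec (AllowedSquareRoot z)
allowed? z = (z ≟ₗ (2 ∷ [])) ⊎-dec (z ≟ₗ (1 ∷ 2 ∷ 3 ∷ [])) ⊎-dec (z ≟ₗ (3 ∷ 2 ∷ 1 ∷ []))
  where _≟ₗ_ = List.≡-dec ℕ._≟_

goodWindow? : ∀ L W → Dec (GoodWindow L W)
goodWindow? L W = ¬? (nthD plus W 0 ≟ nthD plus W 1) →-dec (periodic? plus ⊎-dec periodic? minus) →-dec allowed? _
  where
  periodic? : ∀ s → Dec (PeriodicWindow L s W)
  periodic? s = all? (λ t → nthD plus W (t + L) ≟ s * nthD plus W t) (upTo (2 + L))

-- Decided by evaluation; the depths bring the window length down to 2.
good-windows-2 : All (GoodWindow 2) (windows 2 6)
good-windows-2 = from-yes (all? (goodWindow? 2) (windows 2 6))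

good-windows-6 : All (GoodWindow 6) (windows 3 14)
good-windows-6 = from-yes (all? (goodWindow? 6) (windows 3 14))

good-windows-10 : All (GoodWindow 10) (windows 4 22)
good-windows-10 = from-yes (all? (goodWindow? 10) (windows 4 22))

take-applyUpTo : ∀ {A : Set} (h : ℕ → A) m n → take m (applyUpTo h (m + n)) ≡ applyUpTo h m
take-applyUpTo h zero    n = refl
take-applyUpTo h (suc m) n = cong (h 0 ∷_) (take-applyUpTo (h ∘ suc) m n)

SignPeriodic⇒allowed : ∀ d L v f k s → All (GoodWindow L) (windows d (2 + (L + L))) →
  SignPeriodic (Ppad v f) k L (2 + L) s → RunBoundary (Ppad v f) k →
  AllowedSquareRoot (runLengths (segment (Ppad v f) (suc k) L))
SignPeriodic⇒allowed d L v f k s good per boundary =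
  subst AllowedSquareRoot (cong runLengths inner≡)
    (All.lookup good (segment-∈-windows d (2 + (L + L)) v f k) boundaryᵂ
      (plus⊎minus {λ s → PeriodicWindow L s W} s periodic))
  where
  G = Ppad v f
  W = segment G k (2 + (L + L))
  nth : ∀ t → t < 2 + (L + L) → nthD plus W t ≡ G (k + t)
  nth = nthD-segment G k (2 + (L + L))
  1<W : 1 < 2 + (L + L)
  1<W = s≤s (s≤s z≤n)
  boundaryᵂ : nthD plus W 0 ≢ nthD plus W 1
  boundaryᵂ eq = boundary (begin
    G k            ≡⟨ cong G (sym (+-identityʳ k)) ⟩
    G (k + 0)      ≡⟨ sym (nth 0 (≤-trans (s≤s z≤n) 1<W)) ⟩
    nthD plus W 0  ≡⟨ eq ⟩
    nthD plus W 1  ≡⟨ nth 1 1<W ⟩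
    G (k + 1)      ≡⟨ cong G (+-comm k 1) ⟩
    G (suc k)      ∎)
  periodic : PeriodicWindow L s W
  periodic = applyUpTo⁺₁ (λ t → t) (2 + L) λ {t} t<2+L → begin
    nthD plus W (t + L)  ≡⟨ nth (t + L) (subst (t + L <_) (sym (+-assoc 2 L L)) (+-mono-≤ t<2+L ≤-refl)) ⟩
    G (k + (t + L))      ≡⟨ cong G (sym (+-assoc k t L)) ⟩
    G (k + t + L)        ≡⟨ per t t<2+L ⟩
    s * G (k + t)        ≡⟨ cong (s *_) (sym (nth t (≤-trans t<2+L (+-monoʳ-≤ 2 (m≤m+n L L))))) ⟩
    s * nthD plus W t    ∎
  inner≡ : take L (drop 1 W) ≡ segment G (suc k) L
  inner≡ = begin
    take L (drop 1 W)                          ≡⟨ cong (take L ∘ drop 1) (segment-suc G k (suc (L + L))) ⟩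
    take L (segment G (suc k) (suc (L + L)))   ≡⟨ cong (take L ∘ segment G (suc k)) (sym (+-suc L L)) ⟩
    take L (segment G (suc k) (L + suc L))     ≡⟨ take-applyUpTo _ L (suc L) ⟩
    segment G (suc k) L                        ∎

Ppad-square-allowed : ∀ v f k m z → z ≢ [] → RunBlock (Ppad v f) k m (z ++ z) → AllowedSquareRoot z
Ppad-square-allowed v f k m z z≢[] block with RunBlock-square⇒SignPeriodic (Ppad v f) k m z z≢[] block
... | n , s , periodic , runs with period-lengths v f k (suc n) s periodic (s≤s z≤n)
... | inj₁ refl        = subst AllowedSquareRoot runs
                           (SignPeriodic⇒allowed 2 2 v f k s good-windows-2 periodic (proj₁ block))
... | inj₂ (inj₁ refl) = subst AllowedSquareRoot runs
                           (SignPeriodic⇒allowed 3 6 v f k s good-windows-6 periodic (proj₁ block))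
... | inj₂ (inj₂ refl) = subst AllowedSquareRoot runs
                           (SignPeriodic⇒allowed 4 10 v f k s good-windows-10 periodic (proj₁ block))

-- Prepending v = -(P_f)₀ makes the start of P_f a run boundary of the padded word.
IsRunFactorInf⇒RunBlock : ∀ f w → IsRunFactorInf w (Pinf f) →
  Σ ℕ λ i → Σ ℕ λ m → RunBlock (Ppad (opposite (Pinf f 0)) f) i m w
IsRunFactorInf⇒RunBlock f w (i , m , start , end , runs) =
  i , m , boundary start , subst (λ j → Pinf f (i + m) ≢ Pinf f j) (+-suc i m) end , runs
  where
  boundary : (i ≡ 0 ⊎ Σ ℕ (λ k → (i ≡ suc k) × (Pinf f k ≢ Pinf f i))) →
    RunBoundary (Ppad (opposite (Pinf f 0)) f) i
  boundary (inj₁ refl)                  = s≢opposite[s] (Pinf f 0) ∘ sym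
  boundary (inj₂ (k , refl , Pk≢Pi))    = Pk≢Pi

applyUpTo-nthD : ∀ {A : Set} (d : A) xs → applyUpTo (nthD d xs) (length xs) ≡ xs
applyUpTo-nthD d []       = refl
applyUpTo-nthD d (x ∷ xs) = cong (x ∷_) (applyUpTo-nthD d xs)

applyUpTo-nthD-suc : ∀ {A : Set} (d : A) xs → applyUpTo (nthD d xs) (suc (length xs)) ≡ xs ++ d ∷ []
applyUpTo-nthD-suc d []       = refl
applyUpTo-nthD-suc d (x ∷ xs) = cong (x ∷_) (applyUpTo-nthD-suc d xs)

nthD-length : ∀ {A : Set} (d : A) xs y ys → nthD d (xs ++ y ∷ ys) (length xs) ≡ y
nthD-length d []       y ys = refl
nthD-length d (x ∷ xs) y ys = nthD-length d xs y ys

length-<-++-∷ : ∀ {A : Set} (xs : List A) y ys → length xs < length (xs ++ y ∷ ys)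
length-<-++-∷ []       y ys = s≤s z≤n
length-<-++-∷ (x ∷ xs) y ys = s≤s (length-<-++-∷ xs y ys)

-- Extend f by b = -(last letter of P_f) forever: P_f b is a prefix of the infinite word, and
-- prepending -(P_f)₀ makes P_f a block of complete runs.
R-RunBlock : ∀ f → R f ≢ [] →
  Σ Sign λ v → Σ (ℕ → Sign) λ g → Σ ℕ λ m → RunBlock (Ppad v g) 0 m (R f)
R-RunBlock f R≢[] with P f in P≡
... | []     = ⊥-elim (R≢[] refl)
... | q ∷ qs = opposite q , g , length qs , start , end , runs
  where
  Q = q ∷ qs
  b = opposite (nthD plus Q (length qs))
  g = nthD b f
  G = Ppad (opposite q) g
  Q′ = Q ++ b ∷ map opposite (reverse Q)
  P-extended : P (prefix g (suc (length f))) ≡ Q′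
  P-extended = begin
    P (prefix g (suc (length f)))   ≡⟨ cong P (applyUpTo-nthD-suc b f) ⟩
    P (f ++ b ∷ [])                 ≡⟨ foldl-++ Pstep [] f (b ∷ []) ⟩
    Pstep (P f) b                   ≡⟨ cong (λ w → Pstep w b) P≡ ⟩
    Q′                              ∎
  G-lookup : ∀ t → t < suc (length Q) → G (suc t) ≡ nthD plus Q′ t
  G-lookup t t<1+Q = trans
    (Pinf-lookup g (suc (length f)) t
      (subst (λ w → t < length w) (sym P-extended) (≤-trans t<1+Q (length-<-++-∷ Q b _))))
    (cong (λ w → nthD plus w t) P-extended)
  G-inside : ∀ t → t < length Q → G (suc t) ≡ nthD plus Q t
  G-inside t t<Q = trans (G-lookup t (≤-trans t<Q (n≤1+n _))) (nthD-++ˡ plus Q _ t t<Q)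
  start : RunBoundary G 0
  start eq = s≢opposite[s] q (sym (trans eq (G-inside 0 (s≤s z≤n))))
  end : RunBoundary G (suc (length qs))
  end eq = s≢opposite[s] (nthD plus Q (length qs))
    (trans (sym (G-inside (length qs) ≤-refl)) (trans eq (trans (G-lookup (length Q) ≤-refl) (nthD-length plus Q b _))))
  runs : runLengths (segment G 1 (length Q)) ≡ runLengths Q
  runs = cong runLengths (trans (applyUpTo-cong (length Q) G-inside) (applyUpTo-nthD plus Q))

theorem6 : ((f : List Sign) (z : List ℕ) → z ≢ [] → IsFactor (z ++ z) (R f) → AllowedSquareRoot z)
    × ((f : ℕ → Sign) (z : List ℕ) → z ≢ [] → IsRunFactorInf (z ++ z) (Pinf f) → AllowedSquareRoot z)
theorem6 = finite , infinite
  where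
  finite : (f : List Sign) (z : List ℕ) → z ≢ [] → IsFactor (z ++ z) (R f) → AllowedSquareRoot z
  finite f z z≢[] (x , y , R≡)
    with R-RunBlock f (z≢[] ∘ ++-conicalˡ z z ∘ ++-conicalˡ (z ++ z) y ∘ ++-conicalʳ x _ ∘ trans (sym R≡))
  ... | v , g , m , block
    with RunBlock-factor (Ppad v g) 0 m x (z ++ z) y (z≢[] ∘ ++-conicalˡ z z)
           (subst (RunBlock (Ppad v g) 0 m) R≡ block)
  ... | k , m′ , square = Ppad-square-allowed v g k m′ z z≢[] square
  infinite : (f : ℕ → Sign) (z : List ℕ) → z ≢ [] → IsRunFactorInf (z ++ z) (Pinf f) → AllowedSquareRoot z
  infinite f z z≢[] factor with IsRunFactorInf⇒RunBlock f (z ++ z) factor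
  ... | i , m , square = Ppad-square-allowed (opposite (Pinf f 0)) f i m z z≢[] square
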